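{- Let $x=(x_i)_{i\in\mathbb{Z}}\in\{0,1\}^{\mathbb{Z}}$ be an initial configuration of Rule 110 and let $cell^{(t)}(i)$ denote the value of cell $i$ after $t$ steps of Rule 110 started from $x$. Build the graph $G^{(0)}$ and run the process described in the context. Then for all integers $t\ge0$, all $i\in\mathbb{Z}$ and $j\in\{1,2\}$, the values of the pairs $A_j(i)$ and $B_j(i)$ in $G^{(t)}$ both equal $cell^{(t)}(i)$.
   Context: Rule 110: $cell^{(t+1)}(i)=cell^{(t)}(i+1)$ if $cell^{(t)}(i)=0$; if $cell^{(t)}(i)=1$ then $cell^{(t+1)}(i)=0$ when $cell^{(t)}(i-1)=cell^{(t)}(i+1)=1$ and $1$ otherwise. Construction: for each $i\in\mathbb{Z}$ there are four "pairs" $A_1(i),A_2(i),B_1(i),B_2(i)$, each pair $P$ consisting of two vertices $h_P,l_P$; the value of $P$ in a graph is $1$ if $\{h_P,l_P\}$ is an edge and $0$ otherwise. "Connecting" pairs $P,Q$ means adding the four edges between $\{h_P,l_P\}$ and $\{h_Q,l_Q\}$. Connect $A_j(i)$ with $B_k(i)$ for all $j,k\in\{1,2\}$, and for each $i$ and $j\in\{1,2\}$ connect $A_j(i)$ with $A_j(i+1)$ and $A_j(i)$ with $B_j(i+1)$; in $G^{(0)}$ set the value of all four pairs of cell $i$ to $x_i$; there are no other edges. Times run over $0,\tfrac12,1,\tfrac32,\dots$. For integer $t$, $C^{(t)}$ is the set of pairs $\{h_{A_j(i)},l_{A_j(i)}\}$; $C^{(t+1/2)}$ is the set of pairs $\{h_{B_j(i)},l_{B_j(i)}\}$.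 With $CN^{(t)}(u,v)=|N_{G^{(t)}}(u)\cap N_{G^{(t)}}(v)|$, $CE^{(t)}(u,v)$ the number of edges of $G^{(t)}$ with both endpoints in $N_{G^{(t)}}(u)\cap N_{G^{(t)}}(v)$, and $|E^{(t)}(u,v)|\in\{0,1\}$ indicating whether $\{u,v\}$ is an edge, the energy is: $CE^{(t)}+\beta-10$ if $CN^{(t)}=10$ and $|E^{(t)}(u,v)|=0$; $\beta+12-CE^{(t)}$ if $CN^{(t)}=10$ and $|E^{(t)}(u,v)|=1$; $CE^{(t)}+\beta-6$ if $CN^{(t)}=6$; $\beta-1$ otherwise; $\beta$ is arbitrary and $\alpha=\beta$. Update: each pair in the current interaction set is an edge at the next time iff its energy is $\ge\beta$; all other pairs keep their status. -}

module Defs where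

open import Data.Bool using (Bool; true; false; not; _∧_; if_then_else_)
open import Data.Nat using (ℕ; zero; suc; _*_; _≡ᵇ_)
open import Data.Integer using (ℤ; +_; _+_; _-_; 1ℤ; _≤ᵇ_)
open import Data.List using (List; length)
open import Data.List.Relation.Unary.Unique.Propositional using (Unique)
open import Data.List.Membership.Propositional using (_∈_)
open import Data.Product using (Σ; _×_; _,_)
open import Data.Sum using (_⊎_)
open import Relation.Binary.PropositionalEquality using (_≡_)
open import Function.Bundles using (_⇔_)
open import Data.Empty using (⊥)

-- Rule 110 on configurations ℤ → Bool  (true = 1, false = 0)

rule110 : (ℤ → Bool) → (ℤ → Bool)
rule110 c i = if c i then not (c (i - 1ℤ) ∧ c (i + 1ℤ)) else c (i + 1ℤ)

cell : (ℤ → Bool) → ℕ → ℤ → Bool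
cell x zero    = x
cell x (suc t) = rule110 (cell x t)

data J : Set where
  j₁ j₂ : J

data Pair : Set where
  A B : J → ℤ → Pair

data V : Set where
  h l : Pair → V

-- the pairs that get "connected" in the construction
data Link : Pair → Pair → Set where
  link-AB  : ∀ j k i → Link (A j i) (B k i)
  link-AA  : ∀ j i → Link (A j i) (A j (i + 1ℤ))
  link-AB+ : ∀ j i → Link (A j i) (B j (i + 1ℤ))

data EndOf : V → Pair → Set where
  end-h : ∀ P → EndOf (h P) P
  end-l : ∀ P → EndOf (l P) P

cellOf : Pair → ℤ
cellOf (A _ i) = i
cellOf (B _ i) = i

-- the edge relation of G^{(0)} (as an undirected graph: both orientations)
data Edge₀ (x : ℤ → Bool) : V → V → Set where
  pair-hl : ∀ P → x (cellOf P) ≡ true → Edge₀ x (h P) (l P)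
  pair-lh : ∀ P → x (cellOf P) ≡ true → Edge₀ x (l P) (h P)
  conn    : ∀ {P Q u v} → Link P Q → EndOf u P → EndOf v Q → Edge₀ x u v
  conn'   : ∀ {P Q u v} → Link P Q → EndOf u P → EndOf v Q → Edge₀ x v u

-- Graphs on V as Bool-valued adjacency; the process is indexed by
-- half-steps s ∈ ℕ, s = 2t (so G^{(t)} = E (2 t), G^{(t+1/2)} = E (2 t + 1)).

Graph : Set
Graph = V → V → Bool

value : Graph → Pair → Bool
value G P = G (h P) (l P)

HasCard : {X : Set} → (X → Set) → ℕ → Set
HasCard {X} P n = Σ (List X) λ xs → Unique xs × length xs ≡ n × (∀ w → (w ∈ xs) ⇔ P w)

CommonNbr : Graph → V → V → V → Set
CommonNbr G u v w = G u w ≡ true × G v w ≡ true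

-- ordered pairs (w₁,w₂) forming an edge inside the common neighbourhood;
-- each undirected edge is counted twice
CommonEdgeOrd : Graph → V → V → (V × V) → Set
CommonEdgeOrd G u v (w₁ , w₂) =
  CommonNbr G u v w₁ × CommonNbr G u v w₂ × G w₁ w₂ ≡ true

-- the energy function (cn = CN, ce = CE, e = |E(u,v)|)
energy : ℤ → ℕ → ℕ → Bool → ℤ
energy β cn ce e =
  if cn ≡ᵇ 10
  then (if e then (β + + 12) - + ce else (+ ce + β) - + 10)
  else (if cn ≡ᵇ 6 then (+ ce + β) - + 6 else β - 1ℤ)

evenᵇ : ℕ → Bool
evenᵇ zero    = true
evenᵇ (suc n) = not (evenᵇ n)

InC : ℕ → Pair → Set
InC s (A _ _) = evenᵇ s ≡ true
InC s (B _ _) = evenᵇ s ≡ false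

Interacting : ℕ → V → V → Set
Interacting s u v = Σ Pair λ P → InC s P × ((u ≡ h P × v ≡ l P) ⊎ (u ≡ l P × v ≡ h P))

record Process (x : ℤ → Bool) (β : ℤ) (E : ℕ → Graph) : Set where
  field
    initial  : ∀ u v → (E 0 u v ≡ true) ⇔ Edge₀ x u v
    update   : ∀ s u v → Interacting s u v → ∀ cn ce →
               HasCard (CommonNbr (E s) u v) cn →
               HasCard (CommonEdgeOrd (E s) u v) (2 * ce) →
               E (suc s) u v ≡ (β ≤ᵇ energy β cn ce (E s u v))
    keep     : ∀ s u v → (Interacting s u v → ⊥) → E (suc s) u v ≡ E s u v

module Submission where

-- To each valuation val : Pair → Bool we attach the graph
-- graphOf val: the fixed connections of the construction plus the inner edge
-- {h_P, l_P} for every pair P with val P = true.  We prove the invariant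
--   G^(t)     = graphOf (A ↦ cell^(t),   B ↦ cell^(t)),
--   G^(t+1/2) = graphOf (A ↦ cell^(t+1), B ↦ cell^(t)).
-- Adjacency in graphOf val only depends on the shapes of the two vertices and
-- on the offset between their cells, so a neighbour of a vertex of cell i lies
-- in cells i-1, i, i+1.  Hence the common neighbourhood of h_P, l_P and the
-- edges inside it live in a window of 24 vertices, and CN, CE are lengths of
-- lists computed in that window from the six values of the three cells.  A
-- finite table, checked by evaluation, shows that the energy rule then sets
-- A_j(i) to the Rule 110 update and copies the new A-value into B_j(i).  The
-- update leaves all other vertex pairs unchanged (a frame lemma), which closes
-- the induction; the parameter β cancels from the threshold test.

open import Defs
open import Data.Bool using (Bool; true; false; not; _∧_; _∨_; if_then_else_; T)
import Data.Bool.Properties as 𝔹P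
open import Data.Nat using (ℕ; zero; suc; _*_; _≡ᵇ_; ⌊_/2⌋)
import Data.Nat.Properties as ℕP
import Data.Nat as ℕ
open import Data.Integer using (ℤ; +_; -[1+_]; _+_; _-_; 1ℤ; 0ℤ; _≤ᵇ_)
import Data.Integer.Properties as ℤP
open import Data.Integer.Solver using (module +-*-Solver)
open import Data.List using (List; []; _∷_; length; map; filter; cartesianProduct)
open import Data.List.Properties using (length-map)
open import Data.List.Membership.Propositional using (_∈_)
open import Data.List.Membership.Propositional.Properties
  using (∈-map⁺; ∈-map⁻; ∈-filter⁺; ∈-filter⁻; ∈-cartesianProduct⁺; ∈-cartesianProduct⁻)
open import Data.List.Relation.Unary.Any using (here; there)
import Data.List.Relation.Unary.All as All
open All using ([]; _∷_)
open import Data.List.Relation.Unary.Unique.Propositional using (Unique)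
import Data.List.Relation.Unary.Unique.Propositional.Properties as UniqueP
open import Data.List.Relation.Unary.AllPairs using ([]; _∷_)
open import Data.Product using (Σ; _×_; _,_; proj₁; proj₂; swap)
open import Data.Sum using (_⊎_; inj₁; inj₂)
open import Data.Empty using (⊥-elim)
open import Data.Unit using (tt)
open import Function using (_∘_)
open import Function.Bundles using (_⇔_; mk⇔; Equivalence)
import Function.Properties.Equivalence as ⇔
open import Relation.Nullary using (¬_; Dec; yes; no; _×-dec_)
open import Relation.Nullary.Decidable using (True; toWitness)
open import Relation.Unary using (Decidable)
open import Relation.Binary.PropositionalEquality
  using (_≡_; refl; sym; trans; cong; cong₂; subst; module ≡-Reasoning)

record Finite (X : Set) : Set where
  field
    elements   : List X
    unique     : Unique elements
    enumerates : ∀ x → x ∈ elements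

open Finite

infixr 4 _×ᶠ_

_×ᶠ_ : ∀ {X Y : Set} → Finite X → Finite Y → Finite (X × Y)
elements   (F ×ᶠ G) = cartesianProduct (elements F) (elements G)
unique     (F ×ᶠ G) = UniqueP.cartesianProduct⁺ (unique F) (unique G)
enumerates (F ×ᶠ G) (x , y) = ∈-cartesianProduct⁺ (enumerates F x) (enumerates G y)

decideAll : ∀ {X : Set} {P : X → Set} (F : Finite X) (P? : Decidable P) →
            True (All.all? P? (elements F)) → ∀ x → P x
decideAll F P? ok x = All.lookup (toWitness ok) (enumerates F x)

T-ext : ∀ {a b : Bool} → (T a → T b) → (T b → T a) → a ≡ b
T-ext {false} {false} _ _ = refl
T-ext {true}  {true}  _ _ = refl
T-ext {false} {true}  _ g = ⊥-elim (g tt)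
T-ext {true}  {false} f _ = ⊥-elim (f tt)

∧-true : ∀ a {b} → a ∧ b ≡ true → a ≡ true × b ≡ true
∧-true true refl = refl , refl

∨-true : ∀ a {b} → a ∨ b ≡ true → a ≡ true ⊎ b ≡ true
∨-true true  _ = inj₁ refl
∨-true false p = inj₂ p

≤ᵇ-difference : ∀ i j → (i ≤ᵇ j) ≡ (0ℤ ≤ᵇ j - i)
≤ᵇ-difference i j =
  T-ext (λ p → ℤP.≤⇒≤ᵇ (ℤP.i≤j⇒0≤j-i (ℤP.≤ᵇ⇒≤ {i} {j} p)))
        (λ p → ℤP.≤⇒≤ᵇ (ℤP.0≤i-j⇒j≤i {j} {i} (ℤP.≤ᵇ⇒≤ {0ℤ} {j - i} p)))

module Ring = +-*-Solver
open Ring using (_:+_; _:-_; _:=_; con)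

-- Every branch of the energy is β plus a β-free quantity.
energy-shift : ∀ β cn ce e → energy β cn ce e - β ≡ energy 0ℤ cn ce e
energy-shift β cn ce e with cn ≡ᵇ 10 | cn ≡ᵇ 6 | e
... | true  | _     | true  = Ring.solve 2 (λ β c → ((β :+ con (+ 12)) :- c) :- β := (con 0ℤ :+ con (+ 12)) :- c) refl β (+ ce)
... | true  | _     | false = Ring.solve 2 (λ β c → ((c :+ β) :- con (+ 10)) :- β := (c :+ con 0ℤ) :- con (+ 10)) refl β (+ ce)
... | false | true  | _     = Ring.solve 2 (λ β c → ((c :+ β) :- con (+ 6)) :- β := (c :+ con 0ℤ) :- con (+ 6)) refl β (+ ce)
... | false | false | _     = Ring.solve 1 (λ β → (β :- con 1ℤ) :- β := con 0ℤ :- con 1ℤ) refl β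

threshold-β : ∀ β cn ce e → (β ≤ᵇ energy β cn ce e) ≡ (0ℤ ≤ᵇ energy 0ℤ cn ce e)
threshold-β β cn ce e = trans (≤ᵇ-difference β _) (cong (0ℤ ≤ᵇ_) (energy-shift β cn ce e))

translate-difference : ∀ i a b → (i + a) - (i + b) ≡ a - b
translate-difference = Ring.solve 3 (λ i a b → (i :+ a) :- (i :+ b) := a :- b) refl

add-difference : ∀ m n → m ≡ n + (m - n)
add-difference = Ring.solve 2 (λ m n → m := n :+ (m :- n)) refl

sub-difference : ∀ m n → n ≡ m - (m - n)
sub-difference = Ring.solve 2 (λ m n → n := m :- (m :- n)) refl

successor-offset : ∀ i → (i + 1ℤ) - i ≡ + 1
successor-offset = Ring.solve 1 (λ i → (i :+ con 1ℤ) :- i := con (+ 1)) refl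

predecessor-offset : ∀ i → i - (i + 1ℤ) ≡ -[1+ 0 ]
predecessor-offset = Ring.solve 1 (λ i → i :- (i :+ con 1ℤ) := con -[1+ 0 ]) refl

shifted : ∀ m n {d} → m - n ≡ d → m ≡ n + d
shifted m n eq = trans (add-difference m n) (cong (λ q → n + q) eq)

unshifted : ∀ m n {d} → m - n ≡ d → n ≡ m - d
unshifted m n eq = trans (sub-difference m n) (cong (λ q → m - q) eq)

zero-offset : ∀ m n → m - n ≡ + 0 → m ≡ n
zero-offset m n eq = trans (add-difference m n) (trans (cong (λ d → n + d) eq) (ℤP.+-identityʳ n))

HasCard-⇔ : ∀ {X : Set} {P Q : X → Set} {n} → (∀ w → P w ⇔ Q w) → HasCard P n → HasCard Q n
HasCard-⇔ P⇔Q (xs , xs-unique , xs-length , xs-members) =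
  xs , xs-unique , xs-length , λ w → ⇔.trans (xs-members w) (P⇔Q w)

CommonNbr-swap : ∀ G u v w → CommonNbr G u v w ⇔ CommonNbr G v u w
CommonNbr-swap G u v w = mk⇔ swap swap

CommonEdgeOrd-swap : ∀ G u v p → CommonEdgeOrd G u v p ⇔ CommonEdgeOrd G v u p
CommonEdgeOrd-swap G u v p =
  mk⇔ (λ (c₁ , c₂ , e) → swap c₁ , swap c₂ , e) (λ (c₁ , c₂ , e) → swap c₁ , swap c₂ , e)

data End : Set where
  eh el : End

data Kind : Set where
  kA kB : Kind

-- What adjacency sees of a vertex besides its cell: end, kind and index.
Shape : Set
Shape = End × Kind × J

pairAt : Kind → J → ℤ → Pair
pairAt kA j n = A j n
pairAt kB j n = B j n

endAt : End → Pair → V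
endAt eh P = h P
endAt el P = l P

vertexAt : Shape → ℤ → V
vertexAt (e , k , j) n = endAt e (pairAt k j n)

pairOf : V → Pair
pairOf (h P) = P
pairOf (l P) = P

endOf : V → End
endOf (h _) = eh
endOf (l _) = el

kindOf : Pair → Kind
kindOf (A _ _) = kA
kindOf (B _ _) = kB

indexOf : Pair → J
indexOf (A j _) = j
indexOf (B j _) = j

shapeOf : V → Shape
shapeOf v = endOf v , kindOf (pairOf v) , indexOf (pairOf v)

cellV : V → ℤ
cellV v = cellOf (pairOf v)

vertexAt-shapeOf : ∀ w → vertexAt (shapeOf w) (cellV w) ≡ w
vertexAt-shapeOf (h (A j n)) = refl
vertexAt-shapeOf (h (B j n)) = refl
vertexAt-shapeOf (l (A j n)) = refl
vertexAt-shapeOf (l (B j n)) = refl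

shapeOf-vertexAt : ∀ s n → shapeOf (vertexAt s n) ≡ s
shapeOf-vertexAt (eh , kA , j) n = refl
shapeOf-vertexAt (eh , kB , j) n = refl
shapeOf-vertexAt (el , kA , j) n = refl
shapeOf-vertexAt (el , kB , j) n = refl

cellV-vertexAt : ∀ s n → cellV (vertexAt s n) ≡ n
cellV-vertexAt (eh , kA , j) n = refl
cellV-vertexAt (eh , kB , j) n = refl
cellV-vertexAt (el , kA , j) n = refl
cellV-vertexAt (el , kB , j) n = refl

pairOf-vertexAt : ∀ e k j n → pairOf (vertexAt (e , k , j) n) ≡ pairAt k j n
pairOf-vertexAt eh k j n = refl
pairOf-vertexAt el k j n = refl

eqJ : J → J → Bool
eqJ j₁ j₁ = true
eqJ j₂ j₂ = true
eqJ _  _  = false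

eqJ-refl : ∀ j → eqJ j j ≡ true
eqJ-refl j₁ = refl
eqJ-refl j₂ = refl

eqJ-sound : ∀ j j' → eqJ j j' ≡ true → j ≡ j'
eqJ-sound j₁ j₁ _ = refl
eqJ-sound j₂ j₂ _ = refl

isZero : ℤ → Bool
isZero (+ 0) = true
isZero _     = false

isZero-sound : ∀ d → isZero d ≡ true → d ≡ + 0
isZero-sound (+ 0) _ = refl

-- connectedAt k j k' j' d: the pair (k, j) of cell n and the pair (k', j') of
-- cell n + d are connected by the construction (in either direction).
connectedAt : Kind → J → Kind → J → ℤ → Bool
connectedAt kA j kB k (+ 0)    = true
connectedAt kA j kB k (+ 1)    = eqJ j k
connectedAt kB k kA j (+ 0)    = true
connectedAt kB k kA j -[1+ 0 ] = eqJ j k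
connectedAt kA j kA k (+ 1)    = eqJ j k
connectedAt kA j kA k -[1+ 0 ] = eqJ j k
connectedAt _  _ _  _ _        = false

-- samePairAt k j k' j' d: (k, j) in cell n and (k', j') in cell n + d are the same pair.
samePairAt : Kind → J → Kind → J → ℤ → Bool
samePairAt kA j kA j' d = isZero d ∧ eqJ j j'
samePairAt kB j kB j' d = isZero d ∧ eqJ j j'
samePairAt _  _ _  _  _ = false

oppositeEnds : End → End → Bool
oppositeEnds eh el = true
oppositeEnds el eh = true
oppositeEnds _  _  = false

oppositeAt : Shape → Shape → ℤ → Bool
oppositeAt (e , k , j) (e' , k' , j') d = samePairAt k j k' j' d ∧ oppositeEnds e e'

-- Adjacency of shapes s, s' at cell offset d, when the pair of s has value b.
adjacentAt : Bool → Shape → Shape → ℤ → Bool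
adjacentAt b s s' d =
  connectedAt (proj₁ (proj₂ s)) (proj₂ (proj₂ s)) (proj₁ (proj₂ s')) (proj₂ (proj₂ s')) d
  ∨ (oppositeAt s s' d ∧ b)

graphOf : (Pair → Bool) → Graph
graphOf val u v = adjacentAt (val (pairOf u)) (shapeOf u) (shapeOf v) (cellV v - cellV u)

_≈G_ : Graph → Graph → Set
G ≈G G' = ∀ u v → G u v ≡ G' u v

-- By definition graphOf val u v = connected (pairOf u) (pairOf v) ∨ (opposite u v ∧ val (pairOf u)).
opposite : V → V → Bool
opposite u v = oppositeAt (shapeOf u) (shapeOf v) (cellV v - cellV u)

connected : Pair → Pair → Bool
connected P Q = connectedAt (kindOf P) (indexOf P) (kindOf Q) (indexOf Q) (cellOf Q - cellOf P)

Opposite : V → V → Set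
Opposite u v = Σ Pair λ P → (u ≡ h P × v ≡ l P) ⊎ (u ≡ l P × v ≡ h P)

samePair-refl : ∀ P → samePairAt (kindOf P) (indexOf P) (kindOf P) (indexOf P) (cellOf P - cellOf P) ≡ true
samePair-refl (A j n) rewrite ℤP.+-inverseʳ n | eqJ-refl j = refl
samePair-refl (B j n) rewrite ℤP.+-inverseʳ n | eqJ-refl j = refl

samePair-sound : ∀ P Q → samePairAt (kindOf P) (indexOf P) (kindOf Q) (indexOf Q) (cellOf Q - cellOf P) ≡ true → P ≡ Q
samePair-sound (A j n) (A j' m) same with ∧-true (isZero (m - n)) same
... | z , jj = cong₂ A (eqJ-sound j j' jj) (sym (zero-offset m n (isZero-sound _ z)))
samePair-sound (B j n) (B j' m) same with ∧-true (isZero (m - n)) same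
... | z , jj = cong₂ B (eqJ-sound j j' jj) (sym (zero-offset m n (isZero-sound _ z)))

opposite-sound : ∀ u v → opposite u v ≡ true → Opposite u v
opposite-sound u v opp
  with ∧-true (samePairAt (kindOf (pairOf u)) (indexOf (pairOf u)) (kindOf (pairOf v)) (indexOf (pairOf v))
                          (cellV v - cellV u)) opp
opposite-sound (h P) (l Q) _ | same , _ rewrite samePair-sound P Q same = Q , inj₁ (refl , refl)
opposite-sound (l P) (h Q) _ | same , _ rewrite samePair-sound P Q same = Q , inj₂ (refl , refl)
opposite-sound (h P) (h Q) _ | _ , ()
opposite-sound (l P) (l Q) _ | _ , ()

opposite-complete : ∀ u v → Opposite u v → opposite u v ≡ true
opposite-complete _ _ (P , inj₁ (refl , refl)) rewrite samePair-refl P = refl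
opposite-complete _ _ (P , inj₂ (refl , refl)) rewrite samePair-refl P = refl

graphOf-value : ∀ val P → graphOf val (h P) (l P) ≡ val P × graphOf val (l P) (h P) ≡ val P
graphOf-value val (A j n) rewrite ℤP.+-inverseʳ n | eqJ-refl j = refl , refl
graphOf-value val (B j n) rewrite ℤP.+-inverseʳ n | eqJ-refl j = refl , refl

graphOf-frame : ∀ val val' u v → opposite u v ≡ false → graphOf val u v ≡ graphOf val' u v
graphOf-frame val val' u v notOpposite rewrite notOpposite = refl

valuesAB : (ℤ → Bool) → (ℤ → Bool) → Pair → Bool
valuesAB a b (A _ n) = a n
valuesAB a b (B _ n) = b n

connected-link : ∀ {P Q} → Link P Q → connected P Q ≡ true × connected Q P ≡ true
connected-link (link-AB j k i) rewrite ℤP.+-inverseʳ i = refl , refl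
connected-link (link-AA j i) rewrite successor-offset i | predecessor-offset i = eqJ-refl j , eqJ-refl j
connected-link (link-AB+ j i) rewrite successor-offset i | predecessor-offset i = eqJ-refl j , eqJ-refl j

link-connectedAt : ∀ k j k' j' n m d → m - n ≡ d → connectedAt k j k' j' d ≡ true →
                   Link (pairAt k j n) (pairAt k' j' m) ⊎ Link (pairAt k' j' m) (pairAt k j n)
link-connectedAt kA j kB j' n m (+ 0) eq _ with zero-offset m n eq
... | refl = inj₁ (link-AB j j' n)
link-connectedAt kA j kB j' n m (+ 1) eq c with eqJ-sound j j' c | shifted m n eq
... | refl | refl = inj₁ (link-AB+ j n)
link-connectedAt kB j kA j' n m (+ 0) eq _ with zero-offset m n eq
... | refl = inj₂ (link-AB j' j n)
link-connectedAt kB j kA j' n m -[1+ 0 ] eq c with eqJ-sound j' j c | unshifted m n eq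
... | refl | refl = inj₂ (link-AB+ j' m)
link-connectedAt kA j kA j' n m (+ 1) eq c with eqJ-sound j j' c | shifted m n eq
... | refl | refl = inj₁ (link-AA j n)
link-connectedAt kA j kA j' n m -[1+ 0 ] eq c with eqJ-sound j j' c | unshifted m n eq
... | refl | refl = inj₂ (link-AA j m)
link-connectedAt kA j kA j' n m (+ 0) eq ()
link-connectedAt kA j kA j' n m (+ suc (suc _)) eq ()
link-connectedAt kA j kA j' n m -[1+ suc _ ] eq ()
link-connectedAt kA j kB j' n m (+ suc (suc _)) eq ()
link-connectedAt kA j kB j' n m -[1+ _ ] eq ()
link-connectedAt kB j kA j' n m (+ suc _) eq ()
link-connectedAt kB j kA j' n m -[1+ suc _ ] eq ()
link-connectedAt kB j kB j' n m d eq ()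

link-connected : ∀ P Q → connected P Q ≡ true → Link P Q ⊎ Link Q P
link-connected (A j n) (A j' m) = link-connectedAt kA j kA j' n m _ refl
link-connected (A j n) (B j' m) = link-connectedAt kA j kB j' n m _ refl
link-connected (B j n) (A j' m) = link-connectedAt kB j kA j' n m _ refl
link-connected (B j n) (B j' m) = link-connectedAt kB j kB j' n m _ refl

endOf-EndOf : ∀ u → EndOf u (pairOf u)
endOf-EndOf (h P) = end-h P
endOf-EndOf (l P) = end-l P

EndOf-pairOf : ∀ {u P} → EndOf u P → pairOf u ≡ P
EndOf-pairOf (end-h P) = refl
EndOf-pairOf (end-l P) = refl

graphOf-initial : ∀ x u v → graphOf (valuesAB x x) u v ≡ true ⇔ Edge₀ x u v
graphOf-initial x u v = mk⇔ (toEdge u v) fromEdge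
  where
  value-initial : ∀ P → valuesAB x x P ≡ x (cellOf P)
  value-initial (A _ _) = refl
  value-initial (B _ _) = refl

  fromEdge : ∀ {u v} → Edge₀ x u v → graphOf (valuesAB x x) u v ≡ true
  fromEdge (pair-hl P xP) = trans (proj₁ (graphOf-value (valuesAB x x) P)) (trans (value-initial P) xP)
  fromEdge (pair-lh P xP) = trans (proj₂ (graphOf-value (valuesAB x x) P)) (trans (value-initial P) xP)
  fromEdge (conn lk eu ev)
    rewrite EndOf-pairOf eu | EndOf-pairOf ev | proj₁ (connected-link lk) = refl
  fromEdge (conn' lk ev eu)
    rewrite EndOf-pairOf eu | EndOf-pairOf ev | proj₂ (connected-link lk) = refl

  toEdge : ∀ u v → graphOf (valuesAB x x) u v ≡ true → Edge₀ x u v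
  toEdge u v adj with ∨-true (connected (pairOf u) (pairOf v)) adj
  ... | inj₁ c with link-connected (pairOf u) (pairOf v) c
  ...   | inj₁ lk = conn lk (endOf-EndOf u) (endOf-EndOf v)
  ...   | inj₂ lk = conn' lk (endOf-EndOf v) (endOf-EndOf u)
  toEdge u v adj | inj₂ oppositeAndValue with ∧-true (opposite u v) oppositeAndValue
  ... | opp , xP with opposite-sound u v opp
  ...   | P , inj₁ (refl , refl) = pair-hl P (trans (sym (value-initial P)) xP)
  ...   | P , inj₂ (refl , refl) = pair-lh P (trans (sym (value-initial P)) xP)

data Off : Set where
  m1 o0 p1 : Off

toZ : Off → ℤ
toZ m1 = -[1+ 0 ]
toZ o0 = + 0
toZ p1 = + 1

shift : ℤ → Off → ℤ
shift i m1 = i - 1ℤ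
shift i o0 = i
shift i p1 = i + 1ℤ

shift-toZ : ∀ i o → shift i o ≡ i + toZ o
shift-toZ i m1 = refl
shift-toZ i o0 = sym (ℤP.+-identityʳ i)
shift-toZ i p1 = refl

toZ-injective : ∀ {o o'} → toZ o ≡ toZ o' → o ≡ o'
toZ-injective {m1} {m1} _ = refl
toZ-injective {o0} {o0} _ = refl
toZ-injective {p1} {p1} _ = refl

shift-injective : ∀ i {o o'} → shift i o ≡ shift i o' → o ≡ o'
shift-injective i {o} {o'} eq =
  toZ-injective (trans (sym (shift-offset i o)) (trans (cong (_- i) eq) (shift-offset i o')))
  where
  shift-offset : ∀ i o → shift i o - i ≡ toZ o
  shift-offset i o = trans (cong (_- i) (shift-toZ i o)) (Ring.solve 2 (λ i a → (i :+ a) :- i := a) refl i (toZ o))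

-- The window around cell i.  Window vertices and window pairs: a shape (resp. kind and index) and an
-- offset in {-1, 0, +1}.
WVertex : Set
WVertex = Shape × Off

WPair : Set
WPair = Kind × J × Off

wpairOf : WVertex → WPair
wpairOf ((_ , k , j) , o) = k , j , o

emb : ℤ → WVertex → V
emb i (s , o) = vertexAt s (shift i o)

embP : ℤ → WPair → Pair
embP i (k , j , o) = pairAt k j (shift i o)

wgraph : (WPair → Bool) → WVertex → WVertex → Bool
wgraph lval y y' = adjacentAt (lval (wpairOf y)) (proj₁ y) (proj₁ y') (toZ (proj₂ y') - toZ (proj₂ y))

-- graphOf is translation invariant, so on the window around i it is wgraph.
graphOf-window : ∀ val i lval → (∀ p → val (embP i p) ≡ lval p) →
                 ∀ y y' → graphOf val (emb i y) (emb i y') ≡ wgraph lval y y'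
graphOf-window val i lval agrees ((e , k , j) , o) ((e' , k' , j') , o') =
  cong₄ adjacentAt
    (trans (cong val (pairOf-vertexAt e k j (shift i o))) (agrees (k , j , o)))
    (shapeOf-vertexAt (e , k , j) (shift i o))
    (shapeOf-vertexAt (e' , k' , j') (shift i o'))
    (begin
      cellV (vertexAt (e' , k' , j') (shift i o')) - cellV (vertexAt (e , k , j) (shift i o))
        ≡⟨ cong₂ _-_ (cellV-vertexAt (e' , k' , j') (shift i o')) (cellV-vertexAt (e , k , j) (shift i o)) ⟩
      shift i o' - shift i o
        ≡⟨ cong₂ _-_ (shift-toZ i o') (shift-toZ i o) ⟩
      (i + toZ o') - (i + toZ o)
        ≡⟨ translate-difference i (toZ o') (toZ o) ⟩
      toZ o' - toZ o ∎)
  where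
  open ≡-Reasoning
  cong₄ : ∀ {A B C D E : Set} (f : A → B → C → D → E) {a a' b b' c c' d d'} →
          a ≡ a' → b ≡ b' → c ≡ c' → d ≡ d' → f a b c d ≡ f a' b' c' d'
  cong₄ f refl refl refl refl = refl

emb-injective : ∀ i {y y'} → emb i y ≡ emb i y' → y ≡ y'
emb-injective i {s , o} {s' , o'} eq =
  cong₂ _,_
    (trans (sym (shapeOf-vertexAt s (shift i o))) (trans (cong shapeOf eq) (shapeOf-vertexAt s' (shift i o'))))
    (shift-injective i (trans (sym (cellV-vertexAt s (shift i o))) (trans (cong cellV eq) (cellV-vertexAt s' (shift i o')))))

adjacent-offset : ∀ b s s' d → adjacentAt b s s' d ≡ true → Σ Off λ o → d ≡ toZ o
adjacent-offset b s s' (+ 0)    _ = o0 , refl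
adjacent-offset b s s' (+ 1)    _ = p1 , refl
adjacent-offset b s s' -[1+ 0 ] _ = m1 , refl
adjacent-offset b (_ , kA , _) (_ , kA , _) (+ suc (suc _)) ()
adjacent-offset b (_ , kA , _) (_ , kB , _) (+ suc (suc _)) ()
adjacent-offset b (_ , kB , _) (_ , kA , _) (+ suc (suc _)) ()
adjacent-offset b (_ , kB , _) (_ , kB , _) (+ suc (suc _)) ()
adjacent-offset b (_ , kA , _) (_ , kA , _) -[1+ suc _ ] ()
adjacent-offset b (_ , kA , _) (_ , kB , _) -[1+ suc _ ] ()
adjacent-offset b (_ , kB , _) (_ , kA , _) -[1+ suc _ ] ()
adjacent-offset b (_ , kB , _) (_ , kB , _) -[1+ suc _ ] ()

neighbour-in-window : ∀ val i u w → cellV u ≡ i → graphOf val u w ≡ true → Σ WVertex λ y → w ≡ emb i y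
neighbour-in-window val i u w refl adj with adjacent-offset (val (pairOf u)) (shapeOf u) (shapeOf w) (cellV w - cellV u) adj
... | o , d≡o = (shapeOf w , o) , sym (trans (cong (vertexAt (shapeOf w)) cell-w) (vertexAt-shapeOf w))
  where
  cell-w : shift (cellV u) o ≡ cellV w
  cell-w = trans (shift-toZ (cellV u) o) (sym (trans (shifted (cellV w) (cellV u) refl) (cong (λ q → cellV u + q) d≡o)))

finiteBool : Finite Bool
finiteBool = record
  { elements   = false ∷ true ∷ []
  ; unique     = ((λ ()) ∷ []) ∷ [] ∷ []
  ; enumerates = λ { false → here refl ; true → there (here refl) }
  }

finiteJ : Finite J
finiteJ = record
  { elements   = j₁ ∷ j₂ ∷ []
  ; unique     = ((λ ()) ∷ []) ∷ [] ∷ []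
  ; enumerates = λ { j₁ → here refl ; j₂ → there (here refl) }
  }

finiteEnd : Finite End
finiteEnd = record
  { elements   = eh ∷ el ∷ []
  ; unique     = ((λ ()) ∷ []) ∷ [] ∷ []
  ; enumerates = λ { eh → here refl ; el → there (here refl) }
  }

finiteKind : Finite Kind
finiteKind = record
  { elements   = kA ∷ kB ∷ []
  ; unique     = ((λ ()) ∷ []) ∷ [] ∷ []
  ; enumerates = λ { kA → here refl ; kB → there (here refl) }
  }

finiteOff : Finite Off
finiteOff = record
  { elements   = m1 ∷ o0 ∷ p1 ∷ []
  ; unique     = ((λ ()) ∷ (λ ()) ∷ []) ∷ ((λ ()) ∷ []) ∷ [] ∷ []
  ; enumerates = λ { m1 → here refl ; o0 → there (here refl) ; p1 → there (there (here refl)) }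
  }

finiteWVertex : Finite WVertex
finiteWVertex = (finiteEnd ×ᶠ finiteKind ×ᶠ finiteJ) ×ᶠ finiteOff

wCommonNbr? : ∀ lval y y' → Decidable (λ w → wgraph lval y w ≡ true × wgraph lval y' w ≡ true)
wCommonNbr? lval y y' w = (wgraph lval y w 𝔹P.≟ true) ×-dec (wgraph lval y' w 𝔹P.≟ true)

wEdge? : ∀ lval → Decidable (λ (p : WVertex × WVertex) → wgraph lval (proj₁ p) (proj₂ p) ≡ true)
wEdge? lval (a , b) = wgraph lval a b 𝔹P.≟ true

wCommon : (WPair → Bool) → WVertex → WVertex → List WVertex
wCommon lval y y' = filter (wCommonNbr? lval y y') (elements finiteWVertex)

wCommonEdges : (WPair → Bool) → WVertex → WVertex → List (WVertex × WVertex)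
wCommonEdges lval y y' = filter (wEdge? lval) (cartesianProduct (wCommon lval y y') (wCommon lval y y'))

module WindowCounts (G : Graph) (val : Pair → Bool) (G≈ : G ≈G graphOf val)
                    (i : ℤ) (lval : WPair → Bool) (agrees : ∀ p → val (embP i p) ≡ lval p)
                    (s s' : Shape) where

  y y' : WVertex
  y  = s , o0
  y' = s' , o0

  inWindow : ∀ a b → G (emb i a) (emb i b) ≡ wgraph lval a b
  inWindow a b = trans (G≈ _ _) (graphOf-window val i lval agrees a b)

  common : List WVertex
  common = wCommon lval y y'

  common-unique : Unique common
  common-unique = UniqueP.filter⁺ (wCommonNbr? lval y y') (unique finiteWVertex)

  common-sound : ∀ {z} → z ∈ common → CommonNbr G (emb i y) (emb i y') (emb i z)
  common-sound {z} z∈ with ∈-filter⁻ (wCommonNbr? lval y y') {xs = elements finiteWVertex} z∈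
  ... | _ , (c , c') = trans (inWindow y z) c , trans (inWindow y' z) c'

  common-complete : ∀ w → CommonNbr G (emb i y) (emb i y') w → Σ WVertex λ z → z ∈ common × w ≡ emb i z
  common-complete w (c , c') with neighbour-in-window val i (emb i y) w (cellV-vertexAt s i) (trans (sym (G≈ _ _)) c)
  ... | z , refl =
    z , ∈-filter⁺ (wCommonNbr? lval y y') (enumerates finiteWVertex z)
                  (trans (sym (inWindow y z)) c , trans (sym (inWindow y' z)) c') , refl

  common-card : HasCard (CommonNbr G (emb i y) (emb i y')) (length common)
  common-card =
    map (emb i) common , UniqueP.map⁺ (emb-injective i) common-unique , length-map (emb i) common ,
    λ w → mk⇔ to (from w)
    where
    to : ∀ {w} → w ∈ map (emb i) common → CommonNbr G (emb i y) (emb i y') w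
    to w∈ with ∈-map⁻ (emb i) w∈
    ... | z , z∈ , refl = common-sound z∈
    from : ∀ w → CommonNbr G (emb i y) (emb i y') w → w ∈ map (emb i) common
    from w c with common-complete w c
    ... | z , z∈ , refl = ∈-map⁺ (emb i) z∈

  embPair : WVertex × WVertex → V × V
  embPair (a , b) = emb i a , emb i b

  embPair-injective : ∀ {p q} → embPair p ≡ embPair q → p ≡ q
  embPair-injective eq = cong₂ _,_ (emb-injective i (cong proj₁ eq)) (emb-injective i (cong proj₂ eq))

  edges : List (WVertex × WVertex)
  edges = wCommonEdges lval y y'

  edges-card : HasCard (CommonEdgeOrd G (emb i y) (emb i y')) (length edges)
  edges-card =
    map embPair edges ,
    UniqueP.map⁺ embPair-injective
      (UniqueP.filter⁺ (wEdge? lval) (UniqueP.cartesianProduct⁺ common-unique common-unique)) ,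
    length-map embPair edges ,
    λ p → mk⇔ to (from p)
    where
    to : ∀ {p} → p ∈ map embPair edges → CommonEdgeOrd G (emb i y) (emb i y') p
    to p∈ with ∈-map⁻ embPair p∈
    ... | (a , b) , ab∈ , refl with ∈-filter⁻ (wEdge? lval) {xs = cartesianProduct common common} ab∈
    ...   | ab∈× , e with ∈-cartesianProduct⁻ common common ab∈×
    ...     | a∈ , b∈ = common-sound a∈ , common-sound b∈ , trans (inWindow a b) e
    from : ∀ p → CommonEdgeOrd G (emb i y) (emb i y') p → p ∈ map embPair edges
    from (w₁ , w₂) (c₁ , c₂ , e) with common-complete w₁ c₁ | common-complete w₂ c₂
    ... | a , a∈ , refl | b , b∈ , refl =
      ∈-map⁺ embPair (∈-filter⁺ (wEdge? lval) (∈-cartesianProduct⁺ a∈ b∈) (trans (sym (inWindow a b)) e))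

centre : End → Kind → J → WVertex
centre e k j = (e , k , j) , o0

localUpdate : (WPair → Bool) → Kind → J → Bool
localUpdate lval k j =
  0ℤ ≤ᵇ energy 0ℤ (length (wCommon lval (centre eh k j) (centre el k j)))
                  ⌊ length (wCommonEdges lval (centre eh k j) (centre el k j)) /2⌋
                  (lval (k , j , o0))

-- The ordered count of common edges is even; its half is CE.
EvenEdges : (WPair → Bool) → Kind → J → Set
EvenEdges lval k j = length edges ≡ 2 * ⌊ length edges /2⌋
  where
  edges : List (WVertex × WVertex)
  edges = wCommonEdges lval (centre eh k j) (centre el k j)

evenEdges? : ∀ lval k j → Dec (EvenEdges lval k j)
evenEdges? lval k j = _ ℕ.≟ _

select : Off → Bool → Bool → Bool → Bool
select m1 b₋ b₀ b₊ = b₋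
select o0 b₋ b₀ b₊ = b₀
select p1 b₋ b₀ b₊ = b₊

windowAB : Bool → Bool → Bool → Bool → Bool → Bool → WPair → Bool
windowAB a₋ a₀ a₊ b₋ b₀ b₊ (kA , _ , o) = select o a₋ a₀ a₊
windowAB a₋ a₀ a₊ b₋ b₀ b₊ (kB , _ , o) = select o b₋ b₀ b₊

windowAB-agrees : ∀ a b i p →
  valuesAB a b (embP i p) ≡ windowAB (a (i - 1ℤ)) (a i) (a (i + 1ℤ)) (b (i - 1ℤ)) (b i) (b (i + 1ℤ)) p
windowAB-agrees a b i (kA , _ , m1) = refl
windowAB-agrees a b i (kA , _ , o0) = refl
windowAB-agrees a b i (kA , _ , p1) = refl
windowAB-agrees a b i (kB , _ , m1) = refl
windowAB-agrees a b i (kB , _ , o0) = refl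
windowAB-agrees a b i (kB , _ , p1) = refl

rule : Bool → Bool → Bool → Bool
rule b₋ b₀ b₊ = if b₀ then not (b₋ ∧ b₊) else b₊

UpdatesA : J × Bool × Bool × Bool → Set
UpdatesA (j , b₋ , b₀ , b₊) = EvenEdges w kA j × localUpdate w kA j ≡ rule b₋ b₀ b₊
  where
  w : WPair → Bool
  w = windowAB b₋ b₀ b₊ b₋ b₀ b₊

UpdatesB : J × Bool × Bool × Bool × Bool × Bool × Bool → Set
UpdatesB (j , a₋ , a₀ , a₊ , b₋ , b₀ , b₊) = EvenEdges w kB j × localUpdate w kB j ≡ a₀
  where
  w : WPair → Bool
  w = windowAB a₋ a₀ a₊ b₋ b₀ b₊

updatesA : ∀ j b₋ b₀ b₊ → UpdatesA (j , b₋ , b₀ , b₊)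
updatesA j b₋ b₀ b₊ =
  decideAll (finiteJ ×ᶠ finiteBool ×ᶠ finiteBool ×ᶠ finiteBool) check tt (j , b₋ , b₀ , b₊)
  where
  check : Decidable UpdatesA
  check (j , b₋ , b₀ , b₊) = evenEdges? _ kA j ×-dec (_ 𝔹P.≟ _)

updatesB : ∀ j a₋ a₀ a₊ b₋ b₀ b₊ → UpdatesB (j , a₋ , a₀ , a₊ , b₋ , b₀ , b₊)
updatesB j a₋ a₀ a₊ b₋ b₀ b₊ =
  decideAll (finiteJ ×ᶠ finiteBool ×ᶠ finiteBool ×ᶠ finiteBool ×ᶠ finiteBool ×ᶠ finiteBool ×ᶠ finiteBool)
            check tt (j , a₋ , a₀ , a₊ , b₋ , b₀ , b₊)
  where
  check : Decidable UpdatesB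
  check (j , a₋ , a₀ , a₊ , b₋ , b₀ , b₊) = evenEdges? _ kB j ×-dec (_ 𝔹P.≟ _)

inC? : ∀ s P → Dec (InC s P)
inC? s (A _ _) = evenᵇ s 𝔹P.≟ true
inC? s (B _ _) = evenᵇ s 𝔹P.≟ false

interacting-opposite : ∀ {s u v} → Interacting s u v → Opposite u v
interacting-opposite (P , _ , orientation) = P , orientation

interacting-InC : ∀ {s u v} → Interacting s u v → InC s (pairOf u)
interacting-InC (P , inC , inj₁ (refl , _)) = inC
interacting-InC (P , inC , inj₂ (refl , _)) = inC

double-suc : ∀ t → 2 * suc t ≡ suc (suc (2 * t))
double-suc t = cong suc (ℕP.+-suc t (t ℕ.+ 0))

evenᵇ-double : ∀ t → evenᵇ (2 * t) ≡ true
evenᵇ-double zero = refl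
evenᵇ-double (suc t) = trans (cong evenᵇ (double-suc t)) (cong (λ b → not (not b)) (evenᵇ-double t))

module Run {x : ℤ → Bool} {β : ℤ} {E : ℕ → Graph} (run : Process x β E) where
  open Process run

  -- The two orientations of an interacting pair receive the same energy
  -- test, in which β cancels.
  pairUpdate : ∀ s P → InC s P → E s (l P) (h P) ≡ E s (h P) (l P) → ∀ {cn ce} →
               HasCard (CommonNbr (E s) (h P) (l P)) cn →
               HasCard (CommonEdgeOrd (E s) (h P) (l P)) (2 * ce) →
               E (suc s) (h P) (l P) ≡ (0ℤ ≤ᵇ energy 0ℤ cn ce (E s (h P) (l P))) ×
               E (suc s) (l P) (h P) ≡ (0ℤ ≤ᵇ energy 0ℤ cn ce (E s (h P) (l P)))
  pairUpdate s P inC symmetric {cn} {ce} cnCard ceCard =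
    trans (update s (h P) (l P) (P , inC , inj₁ (refl , refl)) cn ce cnCard ceCard) (threshold-β β cn ce _) ,
    trans (update s (l P) (h P) (P , inC , inj₂ (refl , refl)) cn ce
                  (HasCard-⇔ (CommonNbr-swap (E s) (h P) (l P)) cnCard)
                  (HasCard-⇔ (CommonEdgeOrd-swap (E s) (h P) (l P)) ceCard))
          (trans (cong (λ b → β ≤ᵇ energy β cn ce b) symmetric) (threshold-β β cn ce _))

  frame : ∀ s val val' → E s ≈G graphOf val →
          (∀ P → ¬ InC s P → val' P ≡ val P) →
          (∀ P → InC s P → E (suc s) (h P) (l P) ≡ val' P × E (suc s) (l P) (h P) ≡ val' P) →
          E (suc s) ≈G graphOf val'
  frame s val val' inv unchanged updated u v = byOpposite u v (opposite u v) refl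
    where
    kept : ∀ P → ¬ InC s P → ∀ u v → pairOf u ≡ P → E (suc s) u v ≡ E s u v
    kept P notIn u v refl = keep s u v (notIn ∘ interacting-InC)

    innerEdge : ∀ P → E (suc s) (h P) (l P) ≡ val' P × E (suc s) (l P) (h P) ≡ val' P
    innerEdge P with inC? s P
    ... | yes inC = updated P inC
    ... | no notIn =
      trans (kept P notIn (h P) (l P) refl) (trans (inv _ _) (trans (proj₁ (graphOf-value val P)) (sym (unchanged P notIn)))) ,
      trans (kept P notIn (l P) (h P) refl) (trans (inv _ _) (trans (proj₂ (graphOf-value val P)) (sym (unchanged P notIn))))

    byOpposite : ∀ u v b → opposite u v ≡ b → E (suc s) u v ≡ graphOf val' u v
    byOpposite u v false opp =
      trans (keep s u v notInteracting) (trans (inv u v) (graphOf-frame val val' u v opp))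
      where
      notInteracting : ¬ Interacting s u v
      notInteracting I with trans (sym opp) (opposite-complete u v (interacting-opposite I))
      ... | ()
    byOpposite u v true opp with opposite-sound u v opp
    ... | P , inj₁ (refl , refl) = trans (proj₁ (innerEdge P)) (sym (proj₁ (graphOf-value val' P)))
    ... | P , inj₂ (refl , refl) = trans (proj₂ (innerEdge P)) (sym (proj₂ (graphOf-value val' P)))

  windowUpdate : ∀ s val i lval → E s ≈G graphOf val → (∀ p → val (embP i p) ≡ lval p) →
                 ∀ k j → InC s (pairAt k j i) → EvenEdges lval k j →
                 E (suc s) (h (pairAt k j i)) (l (pairAt k j i)) ≡ localUpdate lval k j ×
                 E (suc s) (l (pairAt k j i)) (h (pairAt k j i)) ≡ localUpdate lval k j
  windowUpdate s val i lval inv agrees k j inC even =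
    trans (proj₁ energyTest) centreValue , trans (proj₂ energyTest) centreValue
    where
    P : Pair
    P = pairAt k j i
    open WindowCounts (E s) val inv i lval agrees (eh , k , j) (el , k , j)

    symmetric : E s (l P) (h P) ≡ E s (h P) (l P)
    symmetric = trans (inv _ _) (trans (proj₂ (graphOf-value val P)) (sym (trans (inv _ _) (proj₁ (graphOf-value val P)))))

    test : Bool
    test = 0ℤ ≤ᵇ energy 0ℤ (length common) ⌊ length edges /2⌋ (E s (h P) (l P))

    energyTest : E (suc s) (h P) (l P) ≡ test × E (suc s) (l P) (h P) ≡ test
    energyTest = pairUpdate s P inC symmetric {length common} {⌊ length edges /2⌋} common-card
                   (subst (HasCard (CommonEdgeOrd (E s) (h P) (l P))) even edges-card)

    centreValue : test ≡ localUpdate lval k j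
    centreValue = cong (λ b → 0ℤ ≤ᵇ energy 0ℤ (length common) ⌊ length edges /2⌋ b)
                       (trans (inv _ _) (trans (proj₁ (graphOf-value val P)) (agrees (k , j , o0))))

  evenStep : ∀ s c → evenᵇ s ≡ true → E s ≈G graphOf (valuesAB c c) →
             E (suc s) ≈G graphOf (valuesAB (rule110 c) c)
  evenStep s c even inv = frame s (valuesAB c c) (valuesAB (rule110 c) c) inv unchanged updated
    where
    unchanged : ∀ P → ¬ InC s P → valuesAB (rule110 c) c P ≡ valuesAB c c P
    unchanged (A _ _) notIn = ⊥-elim (notIn even)
    unchanged (B _ _) _     = refl

    updated : ∀ P → InC s P → E (suc s) (h P) (l P) ≡ valuesAB (rule110 c) c P ×
                              E (suc s) (l P) (h P) ≡ valuesAB (rule110 c) c P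
    updated (A j n) inC =
      trans (proj₁ energyTest) isRule , trans (proj₂ energyTest) isRule
      where
      lval : WPair → Bool
      lval = windowAB (c (n - 1ℤ)) (c n) (c (n + 1ℤ)) (c (n - 1ℤ)) (c n) (c (n + 1ℤ))
      table : UpdatesA (j , c (n - 1ℤ) , c n , c (n + 1ℤ))
      table = updatesA j (c (n - 1ℤ)) (c n) (c (n + 1ℤ))
      isRule : localUpdate lval kA j ≡ rule110 c n
      isRule = proj₂ table
      energyTest : E (suc s) (h (A j n)) (l (A j n)) ≡ localUpdate lval kA j ×
                   E (suc s) (l (A j n)) (h (A j n)) ≡ localUpdate lval kA j
      energyTest = windowUpdate s (valuesAB c c) n lval inv (windowAB-agrees c c n) kA j inC (proj₁ table)
    updated (B _ _) inC with trans (sym even) inC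
    ... | ()

  oddStep : ∀ s c c' → evenᵇ s ≡ false → E s ≈G graphOf (valuesAB c' c) →
            E (suc s) ≈G graphOf (valuesAB c' c')
  oddStep s c c' odd inv = frame s (valuesAB c' c) (valuesAB c' c') inv unchanged updated
    where
    unchanged : ∀ P → ¬ InC s P → valuesAB c' c' P ≡ valuesAB c' c P
    unchanged (A _ _) _     = refl
    unchanged (B _ _) notIn = ⊥-elim (notIn odd)

    updated : ∀ P → InC s P → E (suc s) (h P) (l P) ≡ valuesAB c' c' P ×
                              E (suc s) (l P) (h P) ≡ valuesAB c' c' P
    updated (B j n) inC =
      trans (proj₁ energyTest) copies , trans (proj₂ energyTest) copies
      where
      lval : WPair → Bool
      lval = windowAB (c' (n - 1ℤ)) (c' n) (c' (n + 1ℤ)) (c (n - 1ℤ)) (c n) (c (n + 1ℤ))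
      table : UpdatesB (j , c' (n - 1ℤ) , c' n , c' (n + 1ℤ) , c (n - 1ℤ) , c n , c (n + 1ℤ))
      table = updatesB j (c' (n - 1ℤ)) (c' n) (c' (n + 1ℤ)) (c (n - 1ℤ)) (c n) (c (n + 1ℤ))
      copies : localUpdate lval kB j ≡ c' n
      copies = proj₂ table
      energyTest : E (suc s) (h (B j n)) (l (B j n)) ≡ localUpdate lval kB j ×
                   E (suc s) (l (B j n)) (h (B j n)) ≡ localUpdate lval kB j
      energyTest = windowUpdate s (valuesAB c' c) n lval inv (windowAB-agrees c' c n) kB j inC (proj₁ table)
    updated (A _ _) inC with trans (sym inC) odd
    ... | ()

  invariant : ∀ t → E (2 * t) ≈G graphOf (valuesAB (cell x t) (cell x t))
  invariant zero u v =
    T-ext (λ e → 𝔹P.T-≡ .Equivalence.from (graphOf-initial x u v .Equivalence.from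
                   (initial u v .Equivalence.to (𝔹P.T-≡ .Equivalence.to e))))
          (λ e → 𝔹P.T-≡ .Equivalence.from (initial u v .Equivalence.from
                   (graphOf-initial x u v .Equivalence.to (𝔹P.T-≡ .Equivalence.to e))))
  invariant (suc t) =
    subst (λ s → E s ≈G graphOf (valuesAB (cell x (suc t)) (cell x (suc t)))) (sym (double-suc t))
      (oddStep (suc (2 * t)) (cell x t) (cell x (suc t)) (cong not (evenᵇ-double t))
        (evenStep (2 * t) (cell x t) (evenᵇ-double t) (invariant t)))

lemma16 : (x : ℤ → Bool) (β : ℤ) (E : ℕ → Graph) → Process x β E →
          ∀ (t : ℕ) (i : ℤ) (j : J) →
          value (E (2 * t)) (A j i) ≡ cell x t i × value (E (2 * t)) (B j i) ≡ cell x t i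
lemma16 x β E run t i j =
  trans (invariant t (h (A j i)) (l (A j i))) (proj₁ (graphOf-value (valuesAB (cell x t) (cell x t)) (A j i))) ,
  trans (invariant t (h (B j i)) (l (B j i))) (proj₁ (graphOf-value (valuesAB (cell x t) (cell x t)) (B j i)))
  where open Run run
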